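{- Let $n\geq 1$ and let $G$ be a simple graph of order $2n$ having a perfect matching, with $F(G)=n-1$. Then $f(G)\geq\lfloor n/2\rfloor$.
   Context: For a perfect matching $M$ of $G$, a forcing set of $M$ is a subset of $M$ contained in no other perfect matching of $G$; $f(G,M)$ is its smallest cardinality. $f(G)$ and $F(G)$ are the minimum and maximum of $f(G,M)$ over all perfect matchings $M$ of $G$. -}

module Defs where

open import Data.Nat using (ℕ; _≤_; _<_)
open import Data.Fin using (Fin; toℕ)
open import Data.Fin.Subset using (Subset; _∈_; ∣_∣)
open import Data.Bool using (Bool; true; false)
open import Data.Product using (Σ; ∃; _×_)
open import Relation.Binary.PropositionalEquality using (_≡_; _≢_)
open import Relation.Nullary using (¬_)

record SimpleGraph (m : ℕ) : Set where
  field
    adj   : Fin m → Fin m → Bool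
    sym   : ∀ u v → adj u v ≡ adj v u
    irrefl : ∀ v → adj v v ≡ false
open SimpleGraph public

-- A perfect matching of G, represented by its partner map: every vertex v
-- is matched to partner v ≠ v, the map is an involution, and {v, partner v}
-- is an edge of G.  (A perfect matching is uniquely determined by this map.)
record PerfectMatching {m : ℕ} (G : SimpleGraph m) : Set where
  field
    partner   : Fin m → Fin m
    involutive : ∀ v → partner (partner v) ≡ v
    no-fixed  : ∀ v → partner v ≢ v
    is-edge   : ∀ v → adj G v (partner v) ≡ true
open PerfectMatching public

SameMatching : ∀ {m} {G : SimpleGraph m} → PerfectMatching G → PerfectMatching G → Set
SameMatching M M' = ∀ v → partner M v ≡ partner M' v

-- A subset S of the edges of M is encoded by a vertex subset s, where
-- v ∈ s encodes the edge {v, partner M v}; each edge is named by its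
-- smaller endpoint, so |S| = ∣ s ∣.
IsEdgeSubset : ∀ {m} {G : SimpleGraph m} → PerfectMatching G → Subset m → Set
IsEdgeSubset M s = ∀ v → v ∈ s → toℕ v < toℕ (partner M v)

Contains : ∀ {m} {G : SimpleGraph m} → PerfectMatching G → PerfectMatching G → Subset m → Set
Contains M M' s = ∀ v → v ∈ s → partner M' v ≡ partner M v

IsForcingSet : ∀ {m} (G : SimpleGraph m) → PerfectMatching G → Subset m → Set
IsForcingSet G M s =
  IsEdgeSubset M s × (∀ (M' : PerfectMatching G) → Contains M M' s → SameMatching M M')

ForcingNumber : ∀ {m} (G : SimpleGraph m) → PerfectMatching G → ℕ → Set
ForcingNumber G M k =
  (Σ (Subset _) λ s → IsForcingSet G M s × ∣ s ∣ ≡ k)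
  × (∀ s → IsForcingSet G M s → k ≤ ∣ s ∣)

MaxForcingNumber : ∀ {m} (G : SimpleGraph m) → ℕ → Set
MaxForcingNumber G k =
  (Σ (PerfectMatching G) λ M → ForcingNumber G M k)
  × (∀ (M : PerfectMatching G) (j : ℕ) → ForcingNumber G M j → j ≤ k)

-- Let M₀ be a perfect matching with f(G, M₀) = n − 1. Removing two edges {a, A}, {b, B} from M₀ leaves
-- n − 2 edges, which do not force M₀; the only other ways to match a, A, b, B are along an M₀-alternating
-- 4-cycle, so any two edges of M₀ span such a cycle, and every vertex other than a and A is adjacent to
-- a or to A.  Now let S be a forcing set of a perfect matching M with 2|S| + 2 ≤ n.  The edges of S cover
-- at most 2|S| vertices, so two edges {a, A}, {b, B} of M₀ avoid them and span a 4-cycle a A B b.  A case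
-- analysis on how M matches a, A, b, B, using the adjacency property to close up paths, always yields an
-- M-alternating cycle of length 4, 6 or 8 disjoint from S; switching M along it gives a second perfect
-- matching containing S.

module Submission where

open import Defs
open import Data.Nat using (ℕ; _≤_; _*_; _∸_; _/_)
open import Data.Fin.Subset using (Subset; ∣_∣)

open import Data.Bool using (Bool; true; false; _∨_; _∧_; not; if_then_else_)
import Data.Bool.Properties as Bool
open import Data.Empty using (⊥; ⊥-elim)
open import Data.Fin using (Fin; zero; suc; toℕ)
open import Data.Fin.Permutation using (permutation)
open import Data.Fin.Properties using (_≟_; _<?_; <-cmp; <-asym)
open import Data.Fin.Subset using (_∈_; _∉_)
open import Data.List using (List; []; _∷_)
open import Data.List.Relation.Unary.All using (All; []; _∷_)
open import Data.List.Relation.Unary.Any using (Any; here; there)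
open import Data.Nat using (zero; suc; _+_; _<_; _≤?_; z≤n; s≤s)
open import Data.Nat.DivMod using (m/n*n≤m)
open import Data.Nat.Properties
  using (+-0-commutativeMonoid; +-suc; +-assoc; +-comm; +-identityʳ; +-mono-≤; +-monoʳ-≤; +-cancelˡ-≤; m≤m+n;
         ≤-refl; ≤-trans; ≤-reflexive; 1+n≰n; ≰⇒>; *-cancelˡ-≡; *-monoˡ-≤; module ≤-Reasoning)
open import Data.Nat.Tactic.RingSolver using (solve-∀)
open import Data.Product using (Σ-syntax; _×_; _,_; proj₁; proj₂)
open import Data.Sum using (_⊎_; inj₁; inj₂; swap)
open import Data.Vec using ([]; _∷_; lookup; tabulate)
open import Data.Vec.Properties using (lookup∘tabulate; lookup⇒[]=; []=⇒lookup)
open import Function using (_∘_)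
open import Relation.Binary.Definitions using (DecidableEquality; tri<; tri≈; tri>)
open import Relation.Binary.PropositionalEquality as ≡ using (_≡_; _≢_; refl; trans; cong; cong₂; subst; ≢-sym)
open import Relation.Nullary using (Dec; yes; no; does; ¬_)
open import Relation.Nullary.Decidable using (dec-true; dec-false; _×-dec_)
open import Algebra.Properties.CommutativeMonoid.Sum +-0-commutativeMonoid using (sum; sum-permute; sum-cong-≗)

indicator : Bool → ℕ
indicator true = 1
indicator false = 0

count : ∀ {m} → (Fin m → Bool) → ℕ
count p = sum (indicator ∘ p)

count-cong : ∀ {m} {p q : Fin m → Bool} → (∀ v → p v ≡ q v) → count p ≡ count q
count-cong p≗q = sum-cong-≗ (cong indicator ∘ p≗q)

count-∘-involution : ∀ {m} (p : Fin m → Bool) (σ : Fin m → Fin m) → (∀ v → σ (σ v) ≡ v) →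
                     count (p ∘ σ) ≡ count p
count-∘-involution p σ σσ = ≡.sym (sum-permute (indicator ∘ p) (permutation σ σ σσ σσ))

count-∨+count-∧ : ∀ {m} (p q : Fin m → Bool) →
                  count p + count q ≡ count (λ v → p v ∨ q v) + count (λ v → p v ∧ q v)
count-∨+count-∧ {zero} p q = refl
count-∨+count-∧ {suc m} p q = begin
  (indicator (p zero) + count (p ∘ suc)) + (indicator (q zero) + count (q ∘ suc))
    ≡⟨ interchange (indicator (p zero)) (count (p ∘ suc)) (indicator (q zero)) (count (q ∘ suc)) ⟩
  (indicator (p zero) + indicator (q zero)) + (count (p ∘ suc) + count (q ∘ suc))
    ≡⟨ cong₂ _+_ (pointwise (p zero) (q zero)) (count-∨+count-∧ (p ∘ suc) (q ∘ suc)) ⟩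
  (indicator (p zero ∨ q zero) + indicator (p zero ∧ q zero)) + (count ∨-tail + count ∧-tail)
    ≡⟨ interchange (indicator (p zero ∨ q zero)) (indicator (p zero ∧ q zero)) (count ∨-tail) (count ∧-tail) ⟩
  (indicator (p zero ∨ q zero) + count ∨-tail) + (indicator (p zero ∧ q zero) + count ∧-tail) ∎
  where
  open ≡.≡-Reasoning
  ∨-tail ∧-tail : Fin m → Bool
  ∨-tail v = p (suc v) ∨ q (suc v)
  ∧-tail v = p (suc v) ∧ q (suc v)
  interchange : ∀ a b c d → (a + b) + (c + d) ≡ (a + c) + (b + d)
  interchange a b c d = begin
    (a + b) + (c + d) ≡⟨ +-assoc a b (c + d) ⟩
    a + (b + (c + d)) ≡⟨ cong (a +_) (trans (≡.sym (+-assoc b c d)) (cong (_+ d) (+-comm b c))) ⟩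
    a + ((c + b) + d) ≡⟨ cong (a +_) (+-assoc c b d) ⟩
    a + (c + (b + d)) ≡⟨ ≡.sym (+-assoc a c (b + d)) ⟩
    (a + c) + (b + d) ∎
  pointwise : ∀ x y → indicator x + indicator y ≡ indicator (x ∨ y) + indicator (x ∧ y)
  pointwise true true = refl
  pointwise true false = refl
  pointwise false true = refl
  pointwise false false = refl

count-mono : ∀ {m} {p q : Fin m → Bool} → (∀ v → p v ≡ true → q v ≡ true) → count p ≤ count q
count-mono {zero} p⇒q = z≤n
count-mono {suc m} {p} {q} p⇒q = +-mono-≤ (pointwise (p zero) (q zero) (p⇒q zero)) (count-mono (p⇒q ∘ suc))
  where
  pointwise : ∀ x y → (x ≡ true → y ≡ true) → indicator x ≤ indicator y
  pointwise false y _ = z≤n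
  pointwise true y x⇒y with x⇒y refl
  ... | refl = ≤-refl

count-false : ∀ {m} {p : Fin m → Bool} → (∀ v → p v ≡ false) → count p ≡ 0
count-false {zero} p≡false = refl
count-false {suc m} p≡false rewrite p≡false zero = count-false (p≡false ∘ suc)

count-true : ∀ {m} {p : Fin m → Bool} → (∀ v → p v ≡ true) → count p ≡ m
count-true {zero} p≡true = refl
count-true {suc m} p≡true rewrite p≡true zero = cong suc (count-true (p≡true ∘ suc))

count-∨≤ : ∀ {m} (p q : Fin m → Bool) → count (λ v → p v ∨ q v) ≤ count p + count q
count-∨≤ p q = ≤-trans (m≤m+n _ _) (≤-reflexive (≡.sym (count-∨+count-∧ p q)))

count-disjoint : ∀ {m} (p q : Fin m → Bool) → (∀ v → p v ∧ q v ≡ false) →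
                 count p + count q ≡ count (λ v → p v ∨ q v)
count-disjoint p q disjoint =
  trans (count-∨+count-∧ p q) (trans (cong (count (λ v → p v ∨ q v) +_) (count-false disjoint)) (+-identityʳ _))

count-pos⇒witness : ∀ {m} (p : Fin m → Bool) → 1 ≤ count p → Σ[ v ∈ Fin m ] p v ≡ true
count-pos⇒witness {suc m} p pos with p zero in p0
... | true = zero , p0
... | false with count-pos⇒witness (p ∘ suc) pos
...   | v , pv = suc v , pv

count-remove : ∀ {m} (p : Fin m → Bool) {x : Fin m} → p x ≡ true →
               count p ≡ suc (count (λ v → p v ∧ not (does (v ≟ x))))
count-remove {suc m} p {zero} px rewrite px = cong suc (count-cong (≡.sym ∘ Bool.∧-identityʳ ∘ p ∘ suc))
count-remove {suc m} p {suc x} px = begin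
  indicator (p zero) + count (p ∘ suc)
    ≡⟨ cong (indicator (p zero) +_) (count-remove (p ∘ suc) px) ⟩
  indicator (p zero) + suc (count (λ v → p (suc v) ∧ not (does (v ≟ x))))
    ≡⟨ +-suc _ _ ⟩
  suc (indicator (p zero) + count (λ v → p (suc v) ∧ not (does (v ≟ x))))
    ≡⟨ cong (λ b → suc (indicator b + count (λ v → p (suc v) ∧ not (does (v ≟ x))))) (≡.sym (Bool.∧-identityʳ (p zero))) ⟩
  suc (indicator (p zero ∧ true) + count (λ v → p (suc v) ∧ not (does (v ≟ x)))) ∎
  where open ≡.≡-Reasoning

∣s∣≡count : ∀ {m} (s : Subset m) → ∣ s ∣ ≡ count (lookup s)
∣s∣≡count [] = refl
∣s∣≡count (true ∷ s) = cong suc (∣s∣≡count s)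
∣s∣≡count (false ∷ s) = ∣s∣≡count s

module Pairings {V : Set} (_≟_ : DecidableEquality V) where

  _[_↦_] : (V → V) → V → V → V → V
  (f [ t ↦ a ]) w = if does (w ≟ t) then a else f w

  [↦]-same : ∀ f t a → (f [ t ↦ a ]) t ≡ a
  [↦]-same f t a rewrite dec-true (t ≟ t) refl = refl

  [↦]-other : ∀ f {t} a {w} → w ≢ t → (f [ t ↦ a ]) w ≡ f w
  [↦]-other f {t} a {w} w≢t rewrite dec-false (w ≟ t) w≢t = refl

  record Pairing : Set where
    field
      mate : V → V
      mate-mate : ∀ v → mate (mate v) ≡ v
      mate-≢ : ∀ v → mate v ≢ v
  open Pairing public

  module _ (P : Pairing) where

    mate-injective : ∀ {x y} → mate P x ≡ mate P y → x ≡ y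
    mate-injective {x} {y} eq = trans (≡.sym (mate-mate P x)) (trans (cong (mate P) eq) (mate-mate P y))

    mate-≢-mate : ∀ {x y} → x ≢ y → mate P x ≢ mate P y
    mate-≢-mate x≢y = x≢y ∘ mate-injective

    ≢-mate⇒mate-≢ : ∀ {x y} → x ≢ mate P y → mate P x ≢ y
    ≢-mate⇒mate-≢ {x} x≢y' eq = x≢y' (trans (≡.sym (mate-mate P x)) (cong (mate P) eq))

  DifferentPairs : Pairing → V → V → Set
  DifferentPairs P x y = x ≢ y × x ≢ mate P y

  DifferentPairs-sym : ∀ P {x y} → DifferentPairs P x y → DifferentPairs P y x
  DifferentPairs-sym P (x≢y , x≢y') = ≢-sym x≢y , ≢-sym (≢-mate⇒mate-≢ P x≢y')

  record Rewires (P : Pairing) (q : V → V) (L : List (V × V)) : Set where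
    field
      rewired : All (λ e → q (proj₁ e) ≡ proj₂ e) L
      unchanged : ∀ w → All (λ e → w ≢ proj₁ e) L → q w ≡ mate P w
  open Rewires public

  rewired-or-unchanged : ∀ {P q} L → Rewires P q L →
                         ∀ w → q w ≡ mate P w ⊎ Any (λ e → w ≡ proj₁ e × q w ≡ proj₂ e) L
  rewired-or-unchanged {P} {q} L R w = go L (rewired R) (unchanged R w)
    where
    go : ∀ L → All (λ e → q (proj₁ e) ≡ proj₂ e) L → (All (λ e → w ≢ proj₁ e) L → q w ≡ mate P w) →
         q w ≡ mate P w ⊎ Any (λ e → w ≡ proj₁ e × q w ≡ proj₂ e) L
    go [] [] off = inj₁ (off [])
    go ((v , _) ∷ L) (qv ∷ qL) off with w ≟ v
    ... | yes refl = inj₂ (here (refl , qv))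
    ... | no w≢v with go L qL (λ offL → off (w≢v ∷ offL))
    ...   | inj₁ same = inj₁ same
    ...   | inj₂ found = inj₂ (there found)

  module Switch (P : Pairing) (x u : V) (u≢x : u ≢ x) (u≢x' : u ≢ mate P x) where
    x' u' : V
    x' = mate P x
    u' = mate P u

    private
      f₁ f₂ f₃ : V → V
      f₁ = mate P [ u' ↦ x' ]
      f₂ = f₁ [ x' ↦ u' ]
      f₃ = f₂ [ u ↦ x ]

    switch : V → V
    switch = f₃ [ x ↦ u ]

    private
      x≢u : x ≢ u
      x≢u = ≢-sym u≢x
      x'≢x : x' ≢ x
      x'≢x = mate-≢ P x
      x'≢u : x' ≢ u
      x'≢u = ≢-sym u≢x'
      u'≢x : u' ≢ x
      u'≢x = ≢-mate⇒mate-≢ P u≢x'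
      u'≢u : u' ≢ u
      u'≢u = mate-≢ P u
      u'≢x' : u' ≢ x'
      u'≢x' = mate-≢-mate P u≢x

    switch-x : switch x ≡ u
    switch-x = [↦]-same f₃ x u

    switch-u : switch u ≡ x
    switch-u = trans ([↦]-other f₃ u u≢x) ([↦]-same f₂ u x)

    switch-x' : switch x' ≡ u'
    switch-x' = trans ([↦]-other f₃ u x'≢x) (trans ([↦]-other f₂ x x'≢u) ([↦]-same f₁ x' u'))

    switch-u' : switch u' ≡ x'
    switch-u' = trans ([↦]-other f₃ u u'≢x) (trans ([↦]-other f₂ x u'≢u)
                  (trans ([↦]-other f₁ u' u'≢x') ([↦]-same (mate P) u' x')))

    switch-other : ∀ w → w ≢ x → w ≢ u → w ≢ x' → w ≢ u' → switch w ≡ mate P w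
    switch-other w w≢x w≢u w≢x' w≢u' =
      trans ([↦]-other f₃ u w≢x) (trans ([↦]-other f₂ x w≢u) (trans ([↦]-other f₁ u' w≢x') ([↦]-other (mate P) x' w≢u')))

    switch-involutive : ∀ w → switch (switch w) ≡ w
    switch-involutive w = by-cases (w ≟ x) (w ≟ u) (w ≟ x') (w ≟ u')
      where
      by-cases : Dec (w ≡ x) → Dec (w ≡ u) → Dec (w ≡ x') → Dec (w ≡ u') → switch (switch w) ≡ w
      by-cases (yes refl) _ _ _ = trans (cong switch switch-x) switch-u
      by-cases (no _) (yes refl) _ _ = trans (cong switch switch-u) switch-x
      by-cases (no _) (no _) (yes refl) _ = trans (cong switch switch-x') switch-u'
      by-cases (no _) (no _) (no _) (yes refl) = trans (cong switch switch-u') switch-x'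
      by-cases (no w≢x) (no w≢u) (no w≢x') (no w≢u') =
        trans (cong switch (switch-other w w≢x w≢u w≢x' w≢u'))
          (trans (switch-other (mate P w) (≢-mate⇒mate-≢ P w≢x') (≢-mate⇒mate-≢ P w≢u')
                                          (mate-≢-mate P w≢x) (mate-≢-mate P w≢u))
                 (mate-mate P w))

    switch-≢ : ∀ w → switch w ≢ w
    switch-≢ w = by-cases (w ≟ x) (w ≟ u) (w ≟ x') (w ≟ u')
      where
      by-cases : Dec (w ≡ x) → Dec (w ≡ u) → Dec (w ≡ x') → Dec (w ≡ u') → switch w ≢ w
      by-cases (yes refl) _ _ _ eq = u≢x (trans (≡.sym switch-x) eq)
      by-cases (no _) (yes refl) _ _ eq = x≢u (trans (≡.sym switch-u) eq)
      by-cases (no _) (no _) (yes refl) _ eq = u'≢x' (trans (≡.sym switch-x') eq)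
      by-cases (no _) (no _) (no _) (yes refl) eq = u'≢x' (≡.sym (trans (≡.sym switch-u') eq))
      by-cases (no w≢x) (no w≢u) (no w≢x') (no w≢u') eq = mate-≢ P w (trans (≡.sym (switch-other w w≢x w≢u w≢x' w≢u')) eq)

    switched : Pairing
    switched = record { mate = switch ; mate-mate = switch-involutive ; mate-≢ = switch-≢ }

  cycle-links : Pairing → V → List V → List (V × V)
  cycle-links P r₁ [] = []
  cycle-links P r₁ (r ∷ []) = (mate P r , r₁) ∷ (r₁ , mate P r) ∷ []
  cycle-links P r₁ (r ∷ r' ∷ rs) = (mate P r , r') ∷ (r' , mate P r) ∷ cycle-links P r₁ (r' ∷ rs)

  AlternatingCycle : Pairing → V → List V → Set
  AlternatingCycle P r₁ rs = Σ[ Q ∈ Pairing ] Rewires P (mate Q) (cycle-links P r₁ (r₁ ∷ rs))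

  private
    transport≢ : ∀ {w a b : V} → a ≡ b → w ≢ b → w ≢ a
    transport≢ a≡b w≢b w≡a = w≢b (trans w≡a a≡b)

  alternating-4-cycle : ∀ P r₁ r₂ → DifferentPairs P r₁ r₂ → AlternatingCycle P r₁ (r₂ ∷ [])
  alternating-4-cycle P r₁ r₂ D₁₂@(d₁₂ , _) = S.switched , record
    { rewired = S.switch-x ∷ S.switch-u ∷ trans S.switch-u' (mate-mate P r₁)
              ∷ trans (cong S.switch (≡.sym (mate-mate P r₁))) S.switch-x' ∷ []
    ; unchanged = λ { w (w≢p₁ ∷ w≢r₂ ∷ w≢p₂ ∷ w≢r₁ ∷ []) →
                      S.switch-other w w≢p₁ w≢r₂ (transport≢ (mate-mate P r₁) w≢r₁) w≢p₂ } }
    where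
    e₂₁ : r₂ ≢ mate P r₁
    e₂₁ = proj₂ (DifferentPairs-sym P D₁₂)
    module S = Switch P (mate P r₁) r₂ e₂₁ (transport≢ (mate-mate P r₁) (≢-sym d₁₂))

  alternating-6-cycle : ∀ P r₁ r₂ r₃ → DifferentPairs P r₁ r₂ → DifferentPairs P r₁ r₃ → DifferentPairs P r₂ r₃ →
                        AlternatingCycle P r₁ (r₂ ∷ r₃ ∷ [])
  alternating-6-cycle P r₁ r₂ r₃ D₁₂@(d₁₂ , e₁₂) D₁₃@(d₁₃ , e₁₃) (d₂₃ , e₂₃) = S₂.switched , record
    { rewired = S₂.switch-x ∷ S₂.switch-u
              ∷ trans (cong S₂.switch (≡.sym f₁-r₂)) (trans S₂.switch-u' f₁-p₁)
              ∷ trans (cong S₂.switch (≡.sym f₁-p₁)) (trans S₂.switch-x' f₁-r₂)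
              ∷ trans (S₂.switch-other p₃ (mate-≢-mate P (≢-sym d₁₃)) (≢-sym e₂₃)
                        (transport≢ f₁-p₁ (mate-≢ P r₃)) (transport≢ f₁-r₂ (mate-≢-mate P (≢-sym d₂₃))))
                      S₁.switch-u
              ∷ trans (S₂.switch-other r₁ (≢-sym (mate-≢ P r₁)) d₁₂ (transport≢ f₁-p₁ d₁₃) (transport≢ f₁-r₂ e₁₂))
                      S₁.switch-x
              ∷ []
    ; unchanged = λ { w (w≢p₁ ∷ w≢r₂ ∷ w≢p₂ ∷ w≢r₃ ∷ w≢p₃ ∷ w≢r₁ ∷ []) →
                      trans (S₂.switch-other w w≢p₁ w≢r₂ (transport≢ f₁-p₁ w≢r₃) (transport≢ f₁-r₂ w≢p₂))
                            (S₁.switch-other w w≢r₁ w≢p₃ w≢p₁ (transport≢ (mate-mate P r₃) w≢r₃)) } }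
    where
    p₁ p₂ p₃ : V
    p₁ = mate P r₁
    p₂ = mate P r₂
    p₃ = mate P r₃
    e₂₁ : r₂ ≢ p₁
    e₂₁ = proj₂ (DifferentPairs-sym P D₁₂)
    module S₁ = Switch P r₁ p₃ (≢-sym e₁₃) (mate-≢-mate P (≢-sym d₁₃))
    f₁-p₁ : S₁.switch p₁ ≡ r₃
    f₁-p₁ = trans S₁.switch-x' (mate-mate P r₃)
    f₁-r₂ : S₁.switch r₂ ≡ p₂
    f₁-r₂ = S₁.switch-other r₂ (≢-sym d₁₂) e₂₃ e₂₁ (transport≢ (mate-mate P r₃) d₂₃)
    module S₂ = Switch S₁.switched p₁ r₂ e₂₁ (transport≢ f₁-p₁ d₂₃)

  alternating-8-cycle : ∀ P r₁ r₂ r₃ r₄ →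
                        DifferentPairs P r₁ r₂ → DifferentPairs P r₁ r₃ → DifferentPairs P r₁ r₄ →
                        DifferentPairs P r₂ r₃ → DifferentPairs P r₂ r₄ → DifferentPairs P r₃ r₄ →
                        AlternatingCycle P r₁ (r₂ ∷ r₃ ∷ r₄ ∷ [])
  alternating-8-cycle P r₁ r₂ r₃ r₄ D₁₂@(d₁₂ , e₁₂) D₁₃@(d₁₃ , e₁₃) (d₁₄ , e₁₄) D₂₃@(d₂₃ , e₂₃) D₂₄@(d₂₄ , e₂₄) D₃₄@(d₃₄ , e₃₄) =
    proj₁ inner , extend (rewired (proj₂ inner)) (unchanged (proj₂ inner))
    where
    p₁ p₂ p₃ p₄ : V
    p₁ = mate P r₁
    p₂ = mate P r₂
    p₃ = mate P r₃
    p₄ = mate P r₄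
    e₂₁ : r₂ ≢ p₁
    e₂₁ = proj₂ (DifferentPairs-sym P D₁₂)
    e₃₁ : r₃ ≢ p₁
    e₃₁ = proj₂ (DifferentPairs-sym P D₁₃)
    e₃₂ : r₃ ≢ p₂
    e₃₂ = proj₂ (DifferentPairs-sym P D₂₃)
    e₄₂ : r₄ ≢ p₂
    e₄₂ = proj₂ (DifferentPairs-sym P D₂₄)
    e₄₃ : r₄ ≢ p₃
    e₄₃ = proj₂ (DifferentPairs-sym P D₃₄)
    module S₁ = Switch P r₁ p₄ (≢-sym e₁₄) (mate-≢-mate P (≢-sym d₁₄))
    f₁-r₄ : S₁.switch r₄ ≡ p₁
    f₁-r₄ = trans (cong S₁.switch (≡.sym (mate-mate P r₄))) S₁.switch-u'
    f₁-r₂ : S₁.switch r₂ ≡ p₂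
    f₁-r₂ = S₁.switch-other r₂ (≢-sym d₁₂) e₂₄ e₂₁ (transport≢ (mate-mate P r₄) d₂₄)
    f₁-r₃ : S₁.switch r₃ ≡ p₃
    f₁-r₃ = S₁.switch-other r₃ (≢-sym d₁₃) e₃₄ e₃₁ (transport≢ (mate-mate P r₄) d₃₄)
    inner : AlternatingCycle S₁.switched r₄ (r₂ ∷ r₃ ∷ [])
    inner = alternating-6-cycle S₁.switched r₄ r₂ r₃ (≢-sym d₂₄ , transport≢ f₁-r₂ e₄₂)
              (≢-sym d₃₄ , transport≢ f₁-r₃ e₄₃) (d₂₃ , transport≢ f₁-r₃ e₂₃)
    q : V → V
    q = mate (proj₁ inner)
    extend : All (λ e → q (proj₁ e) ≡ proj₂ e) (cycle-links S₁.switched r₄ (r₄ ∷ r₂ ∷ r₃ ∷ [])) →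
             (∀ w → All (λ e → w ≢ proj₁ e) (cycle-links S₁.switched r₄ (r₄ ∷ r₂ ∷ r₃ ∷ [])) → q w ≡ S₁.switch w) →
             Rewires P q (cycle-links P r₁ (r₁ ∷ r₂ ∷ r₃ ∷ r₄ ∷ []))
    extend (q-p₁ ∷ q-r₂ ∷ q-p₂ ∷ q-r₃ ∷ q-p₃ ∷ q-r₄ ∷ []) q-other = record
      { rewired = trans (cong q (≡.sym f₁-r₄)) q-p₁ ∷ trans q-r₂ f₁-r₄
                ∷ trans (cong q (≡.sym f₁-r₂)) q-p₂ ∷ trans q-r₃ f₁-r₂
                ∷ trans (cong q (≡.sym f₁-r₃)) q-p₃ ∷ trans q-r₄ f₁-r₃
                ∷ trans (q-other p₄ (transport≢ f₁-r₄ (mate-≢-mate P (≢-sym d₁₄)) ∷ ≢-sym e₂₄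
                                    ∷ transport≢ f₁-r₂ (mate-≢-mate P (≢-sym d₂₄)) ∷ ≢-sym e₃₄
                                    ∷ transport≢ f₁-r₃ (mate-≢-mate P (≢-sym d₃₄)) ∷ mate-≢ P r₄ ∷ []))
                        S₁.switch-u
                ∷ trans (q-other r₁ (transport≢ f₁-r₄ (≢-sym (mate-≢ P r₁)) ∷ d₁₂ ∷ transport≢ f₁-r₂ e₁₂
                                    ∷ d₁₃ ∷ transport≢ f₁-r₃ e₁₃ ∷ d₁₄ ∷ []))
                        S₁.switch-x
                ∷ []
      ; unchanged = λ { w (w≢p₁ ∷ w≢r₂ ∷ w≢p₂ ∷ w≢r₃ ∷ w≢p₃ ∷ w≢r₄ ∷ w≢p₄ ∷ w≢r₁ ∷ []) →
          trans (q-other w (transport≢ f₁-r₄ w≢p₁ ∷ w≢r₂ ∷ transport≢ f₁-r₂ w≢p₂ ∷ w≢r₃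
                           ∷ transport≢ f₁-r₃ w≢p₃ ∷ w≢r₄ ∷ []))
                (S₁.switch-other w w≢r₁ w≢p₄ w≢p₁ (transport≢ (mate-mate P r₄) w≢r₄)) } }

  module _ (P P' : Pairing) {x y : V}
           (agree : ∀ w → w ≢ x → w ≢ mate P x → w ≢ y → w ≢ mate P y → mate P' w ≡ mate P w) where
    private
      x' y' : V
      x' = mate P x
      y' = mate P y
      q : V → V
      q = mate P'
      q-flip : ∀ {u v} → q u ≡ v → q v ≡ u
      q-flip {u} refl = mate-mate P' u
      q-fixed-by-agreement : ∀ {u v} → q v ≡ u → v ≢ x → v ≢ x' → v ≢ y → v ≢ y' → mate P u ≡ v
      q-fixed-by-agreement {u} {v} qv≡u v≢x v≢x' v≢y v≢y' =
        trans (cong (mate P) (≡.sym qv≡u)) (trans (cong (mate P) (agree v v≢x v≢x' v≢y v≢y')) (mate-mate P v))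
      x'-stays-inside : q x ≢ x' → q x' ≢ y → q x' ≢ y' → ⊥
      x'-stays-inside qx≢x' qx'≢y qx'≢y' =
        qx'≢x (trans (≡.sym (q-fixed-by-agreement (mate-mate P' x') qx'≢x (mate-≢ P' x') qx'≢y qx'≢y')) (mate-mate P x))
        where
        qx'≢x : q x' ≢ x
        qx'≢x qx'≡x = qx≢x' (q-flip qx'≡x)

    two-pairs-rematched : q x ≡ x' ⊎ (q x ≡ y × q x' ≡ y') ⊎ (q x ≡ y' × q x' ≡ y)
    two-pairs-rematched with q x ≟ x'
    ... | yes qx≡x' = inj₁ qx≡x'
    ... | no qx≢x' with q x ≟ y | q x ≟ y' | q x' ≟ y' | q x' ≟ y
    ...   | yes qx≡y | _ | yes qx'≡y' | _ = inj₂ (inj₁ (qx≡y , qx'≡y'))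
    ...   | no _ | yes qx≡y' | _ | yes qx'≡y = inj₂ (inj₂ (qx≡y' , qx'≡y))
    ...   | yes qx≡y | _ | no qx'≢y' | _ =
      ⊥-elim (x'-stays-inside qx≢x' (λ qx'≡y → mate-≢ P x (≡.sym (trans (≡.sym (q-flip qx≡y)) (q-flip qx'≡y)))) qx'≢y')
    ...   | no _ | yes qx≡y' | _ | no qx'≢y =
      ⊥-elim (x'-stays-inside qx≢x' qx'≢y (λ qx'≡y' → mate-≢ P x (≡.sym (trans (≡.sym (q-flip qx≡y')) (q-flip qx'≡y')))))
    ...   | no qx≢y | no qx≢y' | _ | _ =
      ⊥-elim (qx≢x' (≡.sym (q-fixed-by-agreement (mate-mate P' x) (mate-≢ P' x) qx≢x' qx≢y qx≢y')))

module FinPairings {m : ℕ} = Pairings (_≟_ {m})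
open FinPairings

edge-sym : ∀ {m} (G : SimpleGraph m) {u v} → adj G u v ≡ true → adj G v u ≡ true
edge-sym G {u} {v} uv = trans (SimpleGraph.sym G v u) uv

matching-pairing : ∀ {m} {G : SimpleGraph m} → PerfectMatching G → Pairing
matching-pairing M = record { mate = partner M ; mate-mate = involutive M ; mate-≢ = no-fixed M }

module ForcingSet {m} {G : SimpleGraph m} (M : PerfectMatching G) (s : Subset m)
                  (forces : ∀ M' → Contains M M' s → SameMatching M M') where

  μ : Fin m → Fin m
  μ = partner M

  AvoidingEdge : Fin m × Fin m → Set
  AvoidingEdge (v , w) = adj G v w ≡ true × v ∉ s

  rewiring-along-avoiding-edges-is-trivial :
    (Q : Pairing) (L : List (Fin m × Fin m)) → Rewires (matching-pairing M) (mate Q) L →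
    All AvoidingEdge L → ∀ v → mate Q v ≡ μ v
  rewiring-along-avoiding-edges-is-trivial Q L R avoiding v = ≡.sym (forces M' contains v)
    where
    lookup-avoiding : ∀ {w L} → All AvoidingEdge L → Any (λ e → w ≡ proj₁ e × mate Q w ≡ proj₂ e) L →
                      adj G w (mate Q w) ≡ true × w ∉ s
    lookup-avoiding ((edge , ∉s) ∷ _) (here (refl , Qw)) = subst (λ z → adj G _ z ≡ true) (≡.sym Qw) edge , ∉s
    lookup-avoiding (_ ∷ avoiding) (there found) = lookup-avoiding avoiding found
    is-edge' : ∀ w → adj G w (mate Q w) ≡ true
    is-edge' w with rewired-or-unchanged L R w
    ... | inj₁ same = subst (λ z → adj G w z ≡ true) (≡.sym same) (is-edge M w)
    ... | inj₂ found = proj₁ (lookup-avoiding avoiding found)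
    M' : PerfectMatching G
    M' = record { partner = mate Q ; involutive = mate-mate Q ; no-fixed = mate-≢ Q ; is-edge = is-edge' }
    contains : Contains M M' s
    contains w w∈s with rewired-or-unchanged L R w
    ... | inj₁ same = same
    ... | inj₂ found = ⊥-elim (proj₂ (lookup-avoiding avoiding found) w∈s)

  no-avoiding-alternating-cycle :
    ∀ r₁ r₂ rs → AlternatingCycle (matching-pairing M) r₁ (r₂ ∷ rs) → r₁ ≢ r₂ →
    All AvoidingEdge (cycle-links (matching-pairing M) r₁ (r₁ ∷ r₂ ∷ rs)) → ⊥
  no-avoiding-alternating-cycle r₁ r₂ rs (Q , R) r₁≢r₂ avoiding with rewired R
  ... | Qμr₁ ∷ _ =
    r₁≢r₂ (trans (≡.sym (involutive M r₁)) (trans (≡.sym (rewiring-along-avoiding-edges-is-trivial Q _ R avoiding (μ r₁))) Qμr₁))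

  private
    P : Pairing
    P = matching-pairing M

  no-avoiding-4-cycle : (r₁ s₁ r₂ s₂ : Fin m) → μ r₁ ≡ s₁ → μ r₂ ≡ s₂ → r₁ ≢ r₂ → r₂ ≢ s₁ →
                        adj G s₁ r₂ ≡ true → adj G s₂ r₁ ≡ true →
                        r₁ ∉ s → s₁ ∉ s → r₂ ∉ s → s₂ ∉ s → ⊥
  no-avoiding-4-cycle r₁ _ r₂ _ refl refl d₁₂ e₂₁ g₁ g₂ r₁∉s s₁∉s r₂∉s s₂∉s =
    no-avoiding-alternating-cycle r₁ r₂ []
      (alternating-4-cycle P r₁ r₂ (DifferentPairs-sym P (≢-sym d₁₂ , e₂₁))) d₁₂
      ((g₁ , s₁∉s) ∷ (edge-sym G g₁ , r₂∉s) ∷ (g₂ , s₂∉s) ∷ (edge-sym G g₂ , r₁∉s) ∷ [])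

  no-avoiding-6-cycle : (r₁ s₁ r₂ s₂ r₃ s₃ : Fin m) → μ r₁ ≡ s₁ → μ r₂ ≡ s₂ → μ r₃ ≡ s₃ →
                        r₁ ≢ r₂ → r₁ ≢ r₃ → r₂ ≢ r₃ → r₁ ≢ s₂ → r₁ ≢ s₃ → r₂ ≢ s₃ →
                        adj G s₁ r₂ ≡ true → adj G s₂ r₃ ≡ true → adj G s₃ r₁ ≡ true →
                        r₁ ∉ s → s₁ ∉ s → r₂ ∉ s → s₂ ∉ s → r₃ ∉ s → s₃ ∉ s → ⊥
  no-avoiding-6-cycle r₁ _ r₂ _ r₃ _ refl refl refl d₁₂ d₁₃ d₂₃ e₁₂ e₁₃ e₂₃ g₁ g₂ g₃
                      r₁∉s s₁∉s r₂∉s s₂∉s r₃∉s s₃∉s =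
    no-avoiding-alternating-cycle r₁ r₂ (r₃ ∷ [])
      (alternating-6-cycle P r₁ r₂ r₃ (d₁₂ , e₁₂) (d₁₃ , e₁₃) (d₂₃ , e₂₃)) d₁₂
      ((g₁ , s₁∉s) ∷ (edge-sym G g₁ , r₂∉s) ∷ (g₂ , s₂∉s) ∷ (edge-sym G g₂ , r₃∉s)
       ∷ (g₃ , s₃∉s) ∷ (edge-sym G g₃ , r₁∉s) ∷ [])

  no-avoiding-8-cycle : (r₁ s₁ r₂ s₂ r₃ s₃ r₄ s₄ : Fin m) → μ r₁ ≡ s₁ → μ r₂ ≡ s₂ → μ r₃ ≡ s₃ → μ r₄ ≡ s₄ →
                        r₁ ≢ r₂ → r₁ ≢ r₃ → r₁ ≢ r₄ → r₂ ≢ r₃ → r₂ ≢ r₄ → r₃ ≢ r₄ →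
                        r₁ ≢ s₂ → r₁ ≢ s₃ → r₁ ≢ s₄ → r₂ ≢ s₃ → r₂ ≢ s₄ → r₃ ≢ s₄ →
                        adj G s₁ r₂ ≡ true → adj G s₂ r₃ ≡ true → adj G s₃ r₄ ≡ true → adj G s₄ r₁ ≡ true →
                        r₁ ∉ s → s₁ ∉ s → r₂ ∉ s → s₂ ∉ s → r₃ ∉ s → s₃ ∉ s → r₄ ∉ s → s₄ ∉ s → ⊥
  no-avoiding-8-cycle r₁ _ r₂ _ r₃ _ r₄ _ refl refl refl refl d₁₂ d₁₃ d₁₄ d₂₃ d₂₄ d₃₄ e₁₂ e₁₃ e₁₄ e₂₃ e₂₄ e₃₄
                      g₁ g₂ g₃ g₄ r₁∉s s₁∉s r₂∉s s₂∉s r₃∉s s₃∉s r₄∉s s₄∉s =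
    no-avoiding-alternating-cycle r₁ r₂ (r₃ ∷ r₄ ∷ [])
      (alternating-8-cycle P r₁ r₂ r₃ r₄ (d₁₂ , e₁₂) (d₁₃ , e₁₃) (d₁₄ , e₁₄) (d₂₃ , e₂₃) (d₂₄ , e₂₄) (d₃₄ , e₃₄)) d₁₂
      ((g₁ , s₁∉s) ∷ (edge-sym G g₁ , r₂∉s) ∷ (g₂ , s₂∉s) ∷ (edge-sym G g₂ , r₃∉s)
       ∷ (g₃ , s₃∉s) ∷ (edge-sym G g₃ , r₄∉s) ∷ (g₄ , s₄∉s) ∷ (edge-sym G g₄ , r₁∉s) ∷ [])

module SquareLemma {m} {G : SimpleGraph m} (M : PerfectMatching G) (s : Subset m)
                   (forces : ∀ M' → Contains M M' s → SameMatching M M') where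
  open ForcingSet M s forces

  μ-flip : ∀ {u v} → μ u ≡ v → μ v ≡ u
  μ-flip {u} refl = involutive M u

  μ-flip-≢ : ∀ {u v} → μ u ≢ v → μ v ≢ u
  μ-flip-≢ μu≢v μv≡u = μu≢v (μ-flip μv≡u)

  μ-≢-μ : ∀ {u v} → u ≢ v → μ u ≢ μ v
  μ-≢-μ = mate-≢-mate (matching-pairing M)

  record DominatingSquare (a A b B : Fin m) : Set where
    field
      A≢a : A ≢ a
      b≢a : b ≢ a
      b≢A : b ≢ A
      B≢a : B ≢ a
      B≢A : B ≢ A
      B≢b : B ≢ b
      a~A : adj G a A ≡ true
      b~B : adj G b B ≡ true
      a~b : adj G a b ≡ true
      A~B : adj G A B ≡ true
      a∉s : a ∉ s
      A∉s : A ∉ s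
      b∉s : b ∉ s
      B∉s : B ∉ s
      μa∉s : μ a ∉ s
      μA∉s : μ A ∉ s
      μb∉s : μ b ∉ s
      μB∉s : μ B ∉ s
      aA-dominates : ∀ v → v ≢ a → v ≢ A → adj G v a ≡ true ⊎ adj G v A ≡ true
      bB-dominates : ∀ v → v ≢ b → v ≢ B → adj G v b ≡ true ⊎ adj G v B ≡ true

  square-flip : ∀ {a A b B} → DominatingSquare a A b B → DominatingSquare A a B b
  square-flip c = record
    { A≢a = ≢-sym A≢a ; b≢a = B≢A ; b≢A = B≢a ; B≢a = b≢A ; B≢A = b≢a ; B≢b = ≢-sym B≢b
    ; a~A = edge-sym G a~A ; b~B = edge-sym G b~B ; a~b = A~B ; A~B = a~b
    ; a∉s = A∉s ; A∉s = a∉s ; b∉s = B∉s ; B∉s = b∉s ; μa∉s = μA∉s ; μA∉s = μa∉s ; μb∉s = μB∉s ; μB∉s = μb∉s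
    ; aA-dominates = λ v v≢A v≢a → swap (aA-dominates v v≢a v≢A)
    ; bB-dominates = λ v v≢B v≢b → swap (bB-dominates v v≢b v≢B) }
    where open DominatingSquare c

  square-swap : ∀ {a A b B} → DominatingSquare a A b B → DominatingSquare b B a A
  square-swap c = record
    { A≢a = B≢b ; b≢a = ≢-sym b≢a ; b≢A = ≢-sym B≢a ; B≢a = ≢-sym b≢A ; B≢A = ≢-sym B≢A ; B≢b = A≢a
    ; a~A = b~B ; b~B = a~A ; a~b = edge-sym G a~b ; A~B = edge-sym G A~B
    ; a∉s = b∉s ; A∉s = B∉s ; b∉s = a∉s ; B∉s = A∉s ; μa∉s = μb∉s ; μA∉s = μB∉s ; μb∉s = μa∉s ; μB∉s = μA∉s
    ; aA-dominates = bB-dominates ; bB-dominates = aA-dominates }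
    where open DominatingSquare c

  module _ {a A b B} (c : DominatingSquare a A b B) where
    open DominatingSquare c

    ¬square-μa≡A : μ a ≡ A → ⊥
    ¬square-μa≡A μa≡A with μ b ≟ B
    ... | yes μb≡B = no-avoiding-4-cycle A a b B (μ-flip μa≡A) μb≡B (≢-sym b≢A) b≢a a~b (edge-sym G A~B) A∉s a∉s b∉s B∉s
    ... | no μb≢B with aA-dominates (μ B) Y≢a Y≢A
      where
      Y≢a : μ B ≢ a
      Y≢a e = B≢A (trans (≡.sym (μ-flip e)) μa≡A)
      Y≢A : μ B ≢ A
      Y≢A e = B≢a (trans (≡.sym (μ-flip e)) (μ-flip μa≡A))
    ... | inj₁ Y~a = no-avoiding-4-cycle a A B (μ B) μa≡A refl (≢-sym B≢a) B≢A A~B Y~a a∉s A∉s B∉s μB∉s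
    ... | inj₂ Y~A with aA-dominates (μ b) y≢a y≢A
      where
      y≢a : μ b ≢ a
      y≢a e = b≢A (≡.sym (trans (≡.sym μa≡A) (μ-flip e)))
      y≢A : μ b ≢ A
      y≢A e = b≢a (trans (≡.sym (μ-flip e)) (μ-flip μa≡A))
    ... | inj₂ y~A = no-avoiding-4-cycle b (μ b) A a refl (μ-flip μa≡A) b≢A (≢-sym y≢A) y~A a~b b∉s μb∉s A∉s a∉s
      where
      y≢A : μ b ≢ A
      y≢A e = b≢a (trans (≡.sym (μ-flip e)) (μ-flip μa≡A))
    ... | inj₁ y~a = no-avoiding-6-cycle a A (μ B) B b (μ b) μa≡A (involutive M B) refl
                       (≢-sym Y≢a) (≢-sym b≢a) (μ-flip-≢ μb≢B) (≢-sym B≢a) (≢-sym y≢a) (μ-≢-μ B≢b)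
                       (edge-sym G Y~A) (edge-sym G b~B) y~a a∉s A∉s μB∉s B∉s b∉s μb∉s
      where
      Y≢a : μ B ≢ a
      Y≢a e = B≢A (trans (≡.sym (μ-flip e)) μa≡A)
      y≢a : μ b ≢ a
      y≢a e = b≢A (≡.sym (trans (≡.sym μa≡A) (μ-flip e)))

    ¬square-μa≡b : μ a ≡ b → ⊥
    ¬square-μa≡b μa≡b with μ A ≟ B
    ... | yes μA≡B = no-avoiding-4-cycle a b B A μa≡b (μ-flip μA≡B) (≢-sym B≢a) B≢b b~B (edge-sym G a~A) a∉s b∉s B∉s A∉s
    ... | no μA≢B with aA-dominates (μ B) Y≢a (μ-flip-≢ μA≢B)
      where
      Y≢a : μ B ≢ a
      Y≢a e = B≢b (trans (≡.sym (μ-flip e)) μa≡b)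
    ... | inj₁ Y~a = no-avoiding-4-cycle a b B (μ B) μa≡b refl (≢-sym B≢a) B≢b b~B Y~a a∉s b∉s B∉s μB∉s
    ... | inj₂ Y~A with bB-dominates (μ A) X≢b μA≢B
      where
      X≢b : μ A ≢ b
      X≢b e = A≢a (trans (≡.sym (μ-flip e)) (μ-flip μa≡b))
    ... | inj₁ X~b = no-avoiding-4-cycle a b (μ A) A μa≡b (involutive M A) (≢-sym X≢a) X≢b
                       (edge-sym G X~b) (edge-sym G a~A) a∉s b∉s μA∉s A∉s
      where
      X≢b : μ A ≢ b
      X≢b e = A≢a (trans (≡.sym (μ-flip e)) (μ-flip μa≡b))
      X≢a : μ A ≢ a
      X≢a e = b≢A (trans (≡.sym μa≡b) (μ-flip e))
    ... | inj₂ X~B = no-avoiding-4-cycle A (μ A) B (μ B) refl refl (≢-sym B≢A) (≢-sym μA≢B) X~B Y~A A∉s μA∉s B∉s μB∉s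

    ¬square-μa≡B : μ a ≡ B → ⊥
    ¬square-μa≡B μa≡B with μ A ≟ b
    ... | yes μA≡b = no-avoiding-4-cycle a B b A μa≡B (μ-flip μA≡b) (≢-sym b≢a) (≢-sym B≢b)
                       (edge-sym G b~B) (edge-sym G a~A) a∉s B∉s b∉s A∉s
    ... | no μA≢b with aA-dominates (μ b) y≢a (μ-flip-≢ μA≢b)
      where
      y≢a : μ b ≢ a
      y≢a e = B≢b (trans (≡.sym μa≡B) (μ-flip e))
    ... | inj₁ y~a = no-avoiding-4-cycle a B b (μ b) μa≡B refl (≢-sym b≢a) (≢-sym B≢b) (edge-sym G b~B) y~a a∉s B∉s b∉s μb∉s
    ... | inj₂ y~A with bB-dominates (μ A) μA≢b X≢B
      where
      X≢B : μ A ≢ B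
      X≢B e = A≢a (trans (≡.sym (μ-flip e)) (μ-flip μa≡B))
    ... | inj₂ X~B = no-avoiding-4-cycle A (μ A) B a refl (μ-flip μa≡B) (≢-sym B≢A) (≢-sym X≢B) X~B a~A A∉s μA∉s B∉s a∉s
      where
      X≢B : μ A ≢ B
      X≢B e = A≢a (trans (≡.sym (μ-flip e)) (μ-flip μa≡B))
    ... | inj₁ X~b = no-avoiding-4-cycle A (μ A) b (μ b) refl refl (≢-sym b≢A) (≢-sym μA≢b) X~b y~A A∉s μA∉s b∉s μb∉s

    ¬square-μ-outside : μ a ≢ A → μ a ≢ b → μ a ≢ B → μ A ≢ b → μ A ≢ B → μ b ≢ B → ⊥
    ¬square-μ-outside μa≢A μa≢b μa≢B μA≢b μA≢B μb≢B = by-cases (bB-dominates (μ a) μa≢b μa≢B)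
      where
      X≢a = μ-flip-≢ μa≢A
      y≢a = μ-flip-≢ μa≢b
      y≢A = μ-flip-≢ μA≢b
      Y≢a = μ-flip-≢ μa≢B
      Y≢A = μ-flip-≢ μA≢B
      Y≢b = μ-flip-≢ μb≢B
      cycle-abAB : adj G (μ A) B ≡ true → adj G (μ B) a ≡ true → adj G (μ a) b ≡ true → adj G (μ b) A ≡ true → ⊥
      cycle-abAB X~B Y~a x~b y~A = no-avoiding-8-cycle a (μ a) b (μ b) A (μ A) B (μ B) refl refl refl refl
        (≢-sym b≢a) (≢-sym A≢a) (≢-sym B≢a) b≢A (≢-sym B≢b) (≢-sym B≢A)
        (≢-sym y≢a) (≢-sym X≢a) (≢-sym Y≢a) (≢-sym μA≢b) (≢-sym Y≢b) (≢-sym Y≢A)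
        x~b y~A X~B Y~a a∉s μa∉s b∉s μb∉s A∉s μA∉s B∉s μB∉s
      cycle-aBAb : adj G (μ a) B ≡ true → adj G (μ B) A ≡ true → adj G (μ A) b ≡ true → adj G (μ b) a ≡ true → ⊥
      cycle-aBAb x~B Y~A X~b y~a = no-avoiding-8-cycle a (μ a) B (μ B) A (μ A) b (μ b) refl refl refl refl
        (≢-sym B≢a) (≢-sym A≢a) (≢-sym b≢a) B≢A B≢b (≢-sym b≢A)
        (≢-sym Y≢a) (≢-sym X≢a) (≢-sym y≢a) (≢-sym μA≢B) (≢-sym μb≢B) (≢-sym y≢A)
        x~B Y~A X~b y~a a∉s μa∉s B∉s μB∉s A∉s μA∉s b∉s μb∉s
      by-cases : adj G (μ a) b ≡ true ⊎ adj G (μ a) B ≡ true → ⊥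
      by-cases (inj₁ x~b) with aA-dominates (μ b) y≢a y≢A
      ... | inj₁ y~a = no-avoiding-4-cycle a (μ a) b (μ b) refl refl (≢-sym b≢a) (≢-sym μa≢b) x~b y~a a∉s μa∉s b∉s μb∉s
      ... | inj₂ y~A with bB-dominates (μ A) μA≢b μA≢B
      ... | inj₁ X~b = no-avoiding-4-cycle A (μ A) b (μ b) refl refl (≢-sym b≢A) (≢-sym μA≢b) X~b y~A A∉s μA∉s b∉s μb∉s
      ... | inj₂ X~B with aA-dominates (μ B) Y≢a Y≢A
      ... | inj₂ Y~A = no-avoiding-4-cycle A (μ A) B (μ B) refl refl (≢-sym B≢A) (≢-sym μA≢B) X~B Y~A A∉s μA∉s B∉s μB∉s
      ... | inj₁ Y~a = cycle-abAB X~B Y~a x~b y~A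
      by-cases (inj₂ x~B) with aA-dominates (μ B) Y≢a Y≢A
      ... | inj₁ Y~a = no-avoiding-4-cycle a (μ a) B (μ B) refl refl (≢-sym B≢a) (≢-sym μa≢B) x~B Y~a a∉s μa∉s B∉s μB∉s
      ... | inj₂ Y~A with bB-dominates (μ A) μA≢b μA≢B
      ... | inj₂ X~B = no-avoiding-4-cycle A (μ A) B (μ B) refl refl (≢-sym B≢A) (≢-sym μA≢B) X~B Y~A A∉s μA∉s B∉s μB∉s
      ... | inj₁ X~b with aA-dominates (μ b) y≢a y≢A
      ... | inj₂ y~A = no-avoiding-4-cycle A (μ A) b (μ b) refl refl (≢-sym b≢A) (≢-sym μA≢b) X~b y~A A∉s μA∉s b∉s μb∉s
      ... | inj₁ y~a = cycle-aBAb x~B Y~A X~b y~a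

  ¬dominating-square : ∀ {a A b B} → DominatingSquare a A b B → ⊥
  ¬dominating-square {a} {A} {b} {B} c with μ a ≟ A | μ a ≟ b | μ a ≟ B
  ... | yes μa≡A | _ | _ = ¬square-μa≡A c μa≡A
  ... | no _ | yes μa≡b | _ = ¬square-μa≡b c μa≡b
  ... | no _ | no _ | yes μa≡B = ¬square-μa≡B c μa≡B
  ... | no μa≢A | no μa≢b | no μa≢B with μ A ≟ b | μ A ≟ B
  ... | yes μA≡b | _ = ¬square-μa≡B (square-flip c) μA≡b
  ... | no _ | yes μA≡B = ¬square-μa≡b (square-flip c) μA≡B
  ... | no μA≢b | no μA≢B with μ b ≟ B
  ... | yes μb≡B = ¬square-μa≡A (square-swap c) μb≡B
  ... | no μb≢B = ¬square-μ-outside c μa≢A μa≢b μa≢B μA≢b μA≢B μb≢B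

does-true⇒witness : ∀ {A : Set} (a? : Dec A) → does a? ≡ true → A
does-true⇒witness (yes a) _ = a

module SmallerEnd {m} {G : SimpleGraph m} (M : PerfectMatching G) where

  private
    μ : Fin m → Fin m
    μ = partner M

  smaller-end : Fin m → Bool
  smaller-end v = does (v <? μ v)

  smaller-end-< : ∀ {v} → smaller-end v ≡ true → toℕ v < toℕ (μ v)
  smaller-end-< {v} = does-true⇒witness (v <? μ v)

  smaller-end-unique : ∀ {v} → smaller-end v ≡ true → smaller-end (μ v) ≡ true → ⊥
  smaller-end-unique {v} v-smaller μv-smaller =
    <-asym (smaller-end-< v-smaller) (subst (λ w → toℕ (μ v) < toℕ w) (involutive M v) (smaller-end-< μv-smaller))

  smaller-end-exists : ∀ v → smaller-end v ≡ false → smaller-end (μ v) ≡ true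
  smaller-end-exists v v-larger with <-cmp v (μ v)
  ... | tri< v<μv _ _ with () ← trans (≡.sym (dec-true (v <? μ v) v<μv)) v-larger
  ... | tri≈ _ v≡μv _ = ⊥-elim (no-fixed M v (≡.sym v≡μv))
  ... | tri> _ _ μv<v = dec-true (μ v <? μ (μ v)) (subst (λ w → toℕ (μ v) < toℕ w) (≡.sym (involutive M v)) μv<v)

  count-smaller-end : count smaller-end + count smaller-end ≡ m
  count-smaller-end = begin
    count smaller-end + count smaller-end
      ≡⟨ cong (count smaller-end +_) (≡.sym (count-∘-involution smaller-end μ (involutive M))) ⟩
    count smaller-end + count (smaller-end ∘ μ)
      ≡⟨ count-disjoint smaller-end (smaller-end ∘ μ) not-both ⟩
    count (λ v → smaller-end v ∨ smaller-end (μ v))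
      ≡⟨ count-true one-of ⟩
    m ∎
    where
    open ≡.≡-Reasoning
    not-both : ∀ v → smaller-end v ∧ smaller-end (μ v) ≡ false
    not-both v with smaller-end v in v-end | smaller-end (μ v) in μv-end
    ... | true | true = ⊥-elim (smaller-end-unique v-end μv-end)
    ... | true | false = refl
    ... | false | _ = refl
    one-of : ∀ v → smaller-end v ∨ smaller-end (μ v) ≡ true
    one-of v with smaller-end v in v-end
    ... | true = refl
    ... | false = smaller-end-exists v v-end

∈-tabulate⁺ : ∀ {m} {f : Fin m → Bool} {v} → f v ≡ true → v ∈ tabulate f
∈-tabulate⁺ {f = f} {v} fv = lookup⇒[]= v (tabulate f) (trans (lookup∘tabulate f v) fv)

∈-tabulate⁻ : ∀ {m} {f : Fin m → Bool} {v} → v ∈ tabulate f → f v ≡ true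
∈-tabulate⁻ {f = f} {v} v∈ = trans (≡.sym (lookup∘tabulate f v)) ([]=⇒lookup v∈)

module ExtremalMatching {m} {G : SimpleGraph m} (M₀ : PerfectMatching G) (n : ℕ)
                        (count≡n : count (SmallerEnd.smaller-end M₀) ≡ n)
                        (forcing-≥ : ∀ s → IsForcingSet G M₀ s → n ∸ 1 ≤ ∣ s ∣) where
  open SmallerEnd M₀

  private
    μ₀ : Fin m → Fin m
    μ₀ = partner M₀

  module AllButTwo {a b} (a-end : smaller-end a ≡ true) (b-end : smaller-end b ≡ true) (a≢b : a ≢ b) where

    other-end : Fin m → Bool
    other-end v = (smaller-end v ∧ not (does (v ≟ a))) ∧ not (does (v ≟ b))

    others : Subset m
    others = tabulate other-end

    ∈-others : ∀ {w} → smaller-end w ≡ true → w ≢ a → w ≢ b → w ∈ others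
    ∈-others {w} w-end w≢a w≢b = ∈-tabulate⁺ (begin
      (smaller-end w ∧ not (does (w ≟ a))) ∧ not (does (w ≟ b))
        ≡⟨ cong₂ (λ x y → (x ∧ not y) ∧ not (does (w ≟ b))) w-end (dec-false (w ≟ a) w≢a) ⟩
      not (does (w ≟ b))
        ≡⟨ cong not (dec-false (w ≟ b) w≢b) ⟩
      true ∎)
      where open ≡.≡-Reasoning

    ∈-others⇒smaller-end : ∀ {w} → w ∈ others → smaller-end w ≡ true
    ∈-others⇒smaller-end {w} w∈ = Bool.∧-conicalˡ _ _ (Bool.∧-conicalˡ _ _ (∈-tabulate⁻ w∈))

    ∣others∣+2≡n : ∣ others ∣ + 2 ≡ n
    ∣others∣+2≡n = begin
      ∣ others ∣ + 2
        ≡⟨ +-comm ∣ others ∣ 2 ⟩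
      suc (suc ∣ others ∣)
        ≡⟨ cong (2 +_) (trans (∣s∣≡count others) (count-cong (lookup∘tabulate other-end))) ⟩
      suc (suc (count other-end))
        ≡⟨ cong suc (≡.sym (count-remove (λ v → smaller-end v ∧ not (does (v ≟ a))) b-end-other)) ⟩
      suc (count (λ v → smaller-end v ∧ not (does (v ≟ a))))
        ≡⟨ ≡.sym (count-remove smaller-end a-end) ⟩
      count smaller-end
        ≡⟨ count≡n ⟩
      n ∎
      where
      open ≡.≡-Reasoning
      b-end-other : smaller-end b ∧ not (does (b ≟ a)) ≡ true
      b-end-other = cong₂ (λ x y → x ∧ not y) b-end (dec-false (b ≟ a) (≢-sym a≢b))

    module Rematch (no-parallel : ¬ (adj G a b ≡ true × adj G (μ₀ a) (μ₀ b) ≡ true))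
                   (no-cross : ¬ (adj G a (μ₀ b) ≡ true × adj G (μ₀ a) b ≡ true))
                   (M' : PerfectMatching G) (contains : Contains M₀ M' others) where
      private
        μ' : Fin m → Fin m
        μ' = partner M'

      agrees-off-a-b : ∀ w → w ≢ a → w ≢ μ₀ a → w ≢ b → w ≢ μ₀ b → μ' w ≡ μ₀ w
      agrees-off-a-b w w≢a w≢A w≢b w≢B with smaller-end w in w-end
      ... | true = contains w (∈-others w-end w≢a w≢b)
      ... | false = trans (cong μ' (≡.sym μ'μ₀w≡w)) (involutive M' (μ₀ w))
        where
        μ'μ₀w≡w : μ' (μ₀ w) ≡ w
        μ'μ₀w≡w = trans (contains (μ₀ w) (∈-others (smaller-end-exists w w-end)
                          (≢-mate⇒mate-≢ (matching-pairing M₀) w≢A) (≢-mate⇒mate-≢ (matching-pairing M₀) w≢B)))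
                        (involutive M₀ w)

      M'-edge : ∀ {u v} → μ' u ≡ v → adj G u v ≡ true
      M'-edge {u} refl = is-edge M' u

      keeps-edge : ∀ {x y} → (∀ w → w ≢ x → w ≢ μ₀ x → w ≢ y → w ≢ μ₀ y → μ' w ≡ μ₀ w) →
                   ¬ (adj G x y ≡ true × adj G (μ₀ x) (μ₀ y) ≡ true) →
                   ¬ (adj G x (μ₀ y) ≡ true × adj G (μ₀ x) y ≡ true) → μ' x ≡ μ₀ x
      keeps-edge {x} {y} agree no-parallel no-cross
        with two-pairs-rematched (matching-pairing M₀) (matching-pairing M') agree
      ... | inj₁ μ'x≡μ₀x = μ'x≡μ₀x
      ... | inj₂ (inj₁ (μ'x≡y , μ'X≡Y)) = ⊥-elim (no-parallel (M'-edge μ'x≡y , M'-edge μ'X≡Y))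
      ... | inj₂ (inj₂ (μ'x≡Y , μ'X≡y)) = ⊥-elim (no-cross (M'-edge μ'x≡Y , M'-edge μ'X≡y))


      μ'a≡A : μ' a ≡ μ₀ a
      μ'a≡A = keeps-edge agrees-off-a-b no-parallel no-cross

      μ'b≡B : μ' b ≡ μ₀ b
      μ'b≡B = keeps-edge (λ w w≢b w≢B w≢a w≢A → agrees-off-a-b w w≢a w≢A w≢b w≢B)
                (λ (b~a , B~A) → no-parallel (edge-sym G b~a , edge-sym G B~A))
                (λ (b~A , B~a) → no-cross (edge-sym G B~a , edge-sym G b~A))

      μ'-flip : ∀ {u v} → μ' u ≡ v → μ' v ≡ u
      μ'-flip {u} refl = involutive M' u

      same : SameMatching M₀ M'
      same v with v ≟ a | v ≟ μ₀ a | v ≟ b | v ≟ μ₀ b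
      ... | yes refl | _ | _ | _ = ≡.sym μ'a≡A
      ... | no _ | yes refl | _ | _ = trans (involutive M₀ a) (≡.sym (μ'-flip μ'a≡A))
      ... | no _ | no _ | yes refl | _ = ≡.sym μ'b≡B
      ... | no _ | no _ | no _ | yes refl = trans (involutive M₀ b) (≡.sym (μ'-flip μ'b≡B))
      ... | no v≢a | no v≢A | no v≢b | no v≢B = ≡.sym (agrees-off-a-b v v≢a v≢A v≢b v≢B)

    others-forces : ¬ (adj G a b ≡ true × adj G (μ₀ a) (μ₀ b) ≡ true) →
                    ¬ (adj G a (μ₀ b) ≡ true × adj G (μ₀ a) b ≡ true) → IsForcingSet G M₀ others
    others-forces no-parallel no-cross =
      (λ v v∈ → smaller-end-< (∈-others⇒smaller-end v∈)) , Rematch.same no-parallel no-cross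

  smaller-ends-span-4-cycle : ∀ {a b} → smaller-end a ≡ true → smaller-end b ≡ true → a ≢ b →
                              (adj G a b ≡ true × adj G (μ₀ a) (μ₀ b) ≡ true) ⊎
                              (adj G a (μ₀ b) ≡ true × adj G (μ₀ a) b ≡ true)
  smaller-ends-span-4-cycle {a} {b} a-end b-end a≢b
    with (adj G a b Bool.≟ true) ×-dec (adj G (μ₀ a) (μ₀ b) Bool.≟ true)
       | (adj G a (μ₀ b) Bool.≟ true) ×-dec (adj G (μ₀ a) b Bool.≟ true)
  ... | yes parallel | _ = inj₁ parallel
  ... | no _ | yes cross = inj₂ cross
  ... | no no-parallel | no no-cross = ⊥-elim (1+n≰n (subst (_≤ ∣ others ∣) n∸1≡1+∣others∣ too-small))
    where
    open AllButTwo a-end b-end a≢b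
    too-small : n ∸ 1 ≤ ∣ others ∣
    too-small = forcing-≥ others (others-forces no-parallel no-cross)
    n∸1≡1+∣others∣ : n ∸ 1 ≡ suc ∣ others ∣
    n∸1≡1+∣others∣ = cong (_∸ 1) (trans (≡.sym ∣others∣+2≡n) (+-comm ∣ others ∣ 2))

  smaller-end-dominates : ∀ {a} → smaller-end a ≡ true → ∀ v → v ≢ a → v ≢ μ₀ a →
                          adj G v a ≡ true ⊎ adj G v (μ₀ a) ≡ true
  smaller-end-dominates {a} a-end v v≢a v≢A with smaller-end v in v-end
  ... | true with smaller-ends-span-4-cycle a-end v-end (≢-sym v≢a)
  ...   | inj₁ (a~v , _) = inj₁ (edge-sym G a~v)
  ...   | inj₂ (_ , A~v) = inj₂ (edge-sym G A~v)
  smaller-end-dominates {a} a-end v v≢a v≢A | false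
    with smaller-ends-span-4-cycle a-end (smaller-end-exists v v-end) (≢-sym (≢-mate⇒mate-≢ (matching-pairing M₀) v≢A))
  ...   | inj₁ (_ , A~v) = inj₂ (edge-sym G (subst (λ w → adj G (μ₀ a) w ≡ true) (involutive M₀ v) A~v))
  ...   | inj₂ (a~v , _) = inj₁ (edge-sym G (subst (λ w → adj G a w ≡ true) (involutive M₀ v) a~v))

  module CleanEdges (M : PerfectMatching G) (s : Subset m) where
    private
      μ : Fin m → Fin m
      μ = partner M

    covered : Fin m → Bool
    covered v = lookup s v ∨ lookup s (μ v)

    clean : Fin m → Bool
    clean v = smaller-end v ∧ not (covered v ∨ covered (μ₀ v))

    near far : Fin m → Bool
    near v = smaller-end v ∧ covered v
    far v = smaller-end (μ₀ v) ∧ covered v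

    count-covered : count covered ≤ ∣ s ∣ + ∣ s ∣
    count-covered = ≤-trans (count-∨≤ (lookup s) (lookup s ∘ μ))
      (≤-reflexive (cong₂ _+_ (≡.sym (∣s∣≡count s))
                              (trans (count-∘-involution (lookup s) μ (involutive M)) (≡.sym (∣s∣≡count s)))))

    count-near+far : count near + count far ≤ count covered
    count-near+far = ≤-trans (≤-reflexive (count-disjoint near far not-both)) (count-mono near-or-far⇒covered)
      where
      not-both : ∀ v → near v ∧ far v ≡ false
      not-both v with smaller-end v in v-end | smaller-end (μ₀ v) in μ₀v-end
      ... | true | true = ⊥-elim (smaller-end-unique v-end μ₀v-end)
      ... | true | false = Bool.∧-zeroʳ _
      ... | false | _ = refl
      near-or-far⇒covered : ∀ v → near v ∨ far v ≡ true → covered v ≡ true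
      near-or-far⇒covered v = pointwise (smaller-end v) (smaller-end (μ₀ v)) (covered v)
        where
        pointwise : ∀ x y c → (x ∧ c) ∨ (y ∧ c) ≡ true → c ≡ true
        pointwise _ _ true _ = refl
        pointwise false false false ()
        pointwise false true false ()
        pointwise true false false ()
        pointwise true true false ()

    smaller-end⇒clean-or-covered : ∀ v → smaller-end v ≡ true → clean v ∨ (near v ∨ far (μ₀ v)) ≡ true
    smaller-end⇒clean-or-covered v v-end =
      subst (λ e → clean v ∨ (near v ∨ (e ∧ covered (μ₀ v))) ≡ true) (cong smaller-end (≡.sym (involutive M₀ v)))
            (pointwise (smaller-end v) v-end (covered v) (covered (μ₀ v)))
      where
      pointwise : ∀ e → e ≡ true → ∀ c c' → (e ∧ not (c ∨ c')) ∨ ((e ∧ c) ∨ (e ∧ c')) ≡ true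
      pointwise true _ true _ = refl
      pointwise true _ false true = refl
      pointwise true _ false false = refl

    n≤count-clean+∣s∣+∣s∣ : n ≤ count clean + (∣ s ∣ + ∣ s ∣)
    n≤count-clean+∣s∣+∣s∣ = begin
      n                                              ≡⟨ ≡.sym count≡n ⟩
      count smaller-end                              ≤⟨ count-mono smaller-end⇒clean-or-covered ⟩
      count (λ v → clean v ∨ (near v ∨ far (μ₀ v)))  ≤⟨ count-∨≤ clean _ ⟩
      count clean + count (λ v → near v ∨ far (μ₀ v)) ≤⟨ +-monoʳ-≤ (count clean) (count-∨≤ near (far ∘ μ₀)) ⟩
      count clean + (count near + count (far ∘ μ₀))   ≡⟨ cong (λ k → count clean + (count near + k))
                                                             (count-∘-involution far μ₀ (involutive M₀)) ⟩
      count clean + (count near + count far)          ≤⟨ +-monoʳ-≤ (count clean) (≤-trans count-near+far count-covered) ⟩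
      count clean + (∣ s ∣ + ∣ s ∣)                    ∎
      where open ≤-Reasoning

    module CleanVertex {v} (v-clean : clean v ≡ true) where
      private
        uncovered : covered v ∨ covered (μ₀ v) ≡ false
        uncovered = trans (≡.sym (Bool.not-involutive (covered v ∨ covered (μ₀ v))))
                          (cong not (Bool.∧-conicalʳ (smaller-end v) _ v-clean))
        ∉s : ∀ {w} → lookup s w ≡ false → w ∉ s
        ∉s {w} s-w w∈s with () ← trans (≡.sym ([]=⇒lookup w∈s)) s-w
        v-uncovered : covered v ≡ false
        v-uncovered = Bool.∨-conicalˡ (covered v) (covered (μ₀ v)) uncovered
        μ₀v-uncovered : covered (μ₀ v) ≡ false
        μ₀v-uncovered = Bool.∨-conicalʳ (covered v) (covered (μ₀ v)) uncovered

      end : smaller-end v ≡ true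
      end = Bool.∧-conicalˡ (smaller-end v) _ v-clean

      v∉s : v ∉ s
      v∉s = ∉s (Bool.∨-conicalˡ (lookup s v) (lookup s (μ v)) v-uncovered)

      μv∉s : μ v ∉ s
      μv∉s = ∉s (Bool.∨-conicalʳ (lookup s v) (lookup s (μ v)) v-uncovered)

      μ₀v∉s : μ₀ v ∉ s
      μ₀v∉s = ∉s (Bool.∨-conicalˡ (lookup s (μ₀ v)) (lookup s (μ (μ₀ v))) μ₀v-uncovered)

      μμ₀v∉s : μ (μ₀ v) ∉ s
      μμ₀v∉s = ∉s (Bool.∨-conicalʳ (lookup s (μ₀ v)) (lookup s (μ (μ₀ v))) μ₀v-uncovered)

    two-clean-vertices : 2 ≤ count clean → Σ[ a ∈ Fin m ] Σ[ b ∈ Fin m ] clean a ≡ true × clean b ≡ true × b ≢ a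
    two-clean-vertices two≤count with count-pos⇒witness clean (≤-trans (s≤s z≤n) two≤count)
    ... | a , a-clean with count-pos⇒witness (λ v → clean v ∧ not (does (v ≟ a)))
                             (+-cancelˡ-≤ 1 1 _ (subst (2 ≤_) (count-remove clean a-clean) two≤count))
    ...   | b , b-clean-≢a = a , b , a-clean , Bool.∧-conicalˡ _ _ b-clean-≢a , b≢a
      where
      b≢a : b ≢ a
      b≢a b≡a with () ← trans (≡.sym (Bool.∧-conicalʳ _ _ b-clean-≢a)) (cong not (dec-true (b ≟ a) b≡a))

    module _ (forces : ∀ M' → Contains M M' s → SameMatching M M')
             {a b} (a-clean : clean a ≡ true) (b-clean : clean b ≡ true) (b≢a : b ≢ a) where
      open SquareLemma M s forces
      private
        module A = CleanVertex a-clean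
        module B = CleanVertex b-clean
        b≢A : b ≢ μ₀ a
        b≢A b≡A = smaller-end-unique A.end (subst (λ w → smaller-end w ≡ true) b≡A B.end)
        B≢a : μ₀ b ≢ a
        B≢a B≡a = smaller-end-unique B.end (subst (λ w → smaller-end w ≡ true) (≡.sym B≡a) A.end)
        B≢A : μ₀ b ≢ μ₀ a
        B≢A = mate-≢-mate (matching-pairing M₀) b≢a

      ¬two-clean-vertices : ⊥
      ¬two-clean-vertices with smaller-ends-span-4-cycle A.end B.end (≢-sym b≢a)
      ... | inj₁ (a~b , A~B) = ¬dominating-square {a} {μ₀ a} {b} {μ₀ b} record
        { A≢a = no-fixed M₀ a ; b≢a = b≢a ; b≢A = b≢A ; B≢a = B≢a ; B≢A = B≢A ; B≢b = no-fixed M₀ b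
        ; a~A = is-edge M₀ a ; b~B = is-edge M₀ b ; a~b = a~b ; A~B = A~B
        ; a∉s = A.v∉s ; A∉s = A.μ₀v∉s ; b∉s = B.v∉s ; B∉s = B.μ₀v∉s
        ; μa∉s = A.μv∉s ; μA∉s = A.μμ₀v∉s ; μb∉s = B.μv∉s ; μB∉s = B.μμ₀v∉s
        ; aA-dominates = smaller-end-dominates A.end ; bB-dominates = smaller-end-dominates B.end }
      ... | inj₂ (a~B , A~b) = ¬dominating-square {a} {μ₀ a} {μ₀ b} {b} record
        { A≢a = no-fixed M₀ a ; b≢a = B≢a ; b≢A = B≢A ; B≢a = b≢a ; B≢A = b≢A ; B≢b = ≢-sym (no-fixed M₀ b)
        ; a~A = is-edge M₀ a ; b~B = edge-sym G (is-edge M₀ b) ; a~b = a~B ; A~B = A~b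
        ; a∉s = A.v∉s ; A∉s = A.μ₀v∉s ; b∉s = B.μ₀v∉s ; B∉s = B.v∉s
        ; μa∉s = A.μv∉s ; μA∉s = A.μμ₀v∉s ; μb∉s = B.μμ₀v∉s ; μB∉s = B.μv∉s
        ; aA-dominates = smaller-end-dominates A.end
        ; bB-dominates = λ v v≢B v≢b → swap (smaller-end-dominates B.end v v≢b v≢B) }

    no-small-forcing-set : IsForcingSet G M s → ∣ s ∣ + ∣ s ∣ + 2 ≤ n → ⊥
    no-small-forcing-set (_ , forces) small with two-clean-vertices two≤count-clean
      where
      two≤count-clean : 2 ≤ count clean
      two≤count-clean = +-cancelˡ-≤ (∣ s ∣ + ∣ s ∣) 2 (count clean)
        (≤-trans small (≤-trans n≤count-clean+∣s∣+∣s∣ (≤-reflexive (+-comm (count clean) (∣ s ∣ + ∣ s ∣)))))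
    ... | a , b , a-clean , b-clean , b≢a = ¬two-clean-vertices forces a-clean b-clean b≢a

double+2≡suc*2 : ∀ k → k + k + 2 ≡ suc k * 2
double+2≡suc*2 = solve-∀

corollary5p2 : (n : ℕ) → 1 ≤ n → (G : SimpleGraph (2 * n)) → PerfectMatching G → MaxForcingNumber G (n ∸ 1) → (M : PerfectMatching G) → (s : Subset (2 * n)) → IsForcingSet G M s → n / 2 ≤ ∣ s ∣
corollary5p2 n _ G _ ((M₀ , (_ , forcing-≥)) , _) M s forcing with n / 2 ≤? ∣ s ∣
... | yes n/2≤∣s∣ = n/2≤∣s∣
... | no n/2≰∣s∣ = ⊥-elim (CleanEdges.no-small-forcing-set M s forcing small)
  where
  open SmallerEnd M₀
  count≡n : count smaller-end ≡ n
  count≡n = *-cancelˡ-≡ (count smaller-end) n 2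
              (trans (cong (count smaller-end +_) (+-identityʳ (count smaller-end))) count-smaller-end)
  open ExtremalMatching M₀ n count≡n forcing-≥
  small : ∣ s ∣ + ∣ s ∣ + 2 ≤ n
  small = ≤-trans (≤-reflexive (double+2≡suc*2 ∣ s ∣)) (≤-trans (*-monoˡ-≤ 2 (≰⇒> n/2≰∣s∣)) (m/n*n≤m n 2))
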